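{- Let $G$ be a finite simple connected graph on $n+s$ vertices and let $S\subseteq V(G)$ with $|S|=s\geq 1$. Suppose that each non-terminal level with respect to $S$ contains at least $2$ vertices. Then \[ \sigma(S)\leq \begin{cases} \frac{1}{4}(n^2+2n), & 2\mid n,\\[2pt] \frac{1}{4}(n^2+2n+1), & 2\nmid n. \end{cases} \]
   Context: For $u\in V(G)$, $d_G(S,u)=\min\{d_G(u,v): v\in S\}$, where $d_G$ is the graph distance. The status of $S$ is $\sigma(S)=\sigma_G(S)=\sum_{u\in V(G)} d_G(S,u)$. For $i\geq 1$, the $i$-th level with respect to $S$ is the set of vertices at distance exactly $i$ from $S$; the terminal level is the farthest (largest $i$) nonempty level, and the non-terminal levels are the nonempty levels $i\geq 1$ other than the terminal one. -}

module Defs where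

open import Data.Nat using (ℕ; zero; suc; _≤_)
open import Data.Fin using (Fin)
open import Data.Fin.Subset using (Subset; _∈_)
open import Data.List using (tabulate)
open import Data.Nat.ListAction using (sum)
open import Data.Product using (Σ; ∃; _×_)
open import Relation.Binary.PropositionalEquality using (_≡_)
open import Relation.Nullary using (¬_)

record SimpleGraph (N : ℕ) : Set₁ where
  field
    Adj       : Fin N → Fin N → Set
    symmetric : ∀ {u v} → Adj u v → Adj v u
    irreflex  : ∀ {u} → ¬ Adj u u
open SimpleGraph public

data Walk {N : ℕ} (G : SimpleGraph N) : Fin N → Fin N → ℕ → Set where
  here : ∀ {u} → Walk G u u zero
  step : ∀ {u w v k} → Adj G u w → Walk G w v k → Walk G u v (suc k)

Connected : ∀ {N} → SimpleGraph N → Set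
Connected {N} G = ∀ (u v : Fin N) → ∃ λ k → Walk G u v k

IsDist : ∀ {N} → SimpleGraph N → Fin N → Fin N → ℕ → Set
IsDist G u v k = Walk G u v k × (∀ m → Walk G u v m → k ≤ m)

IsSetDist : ∀ {N} → SimpleGraph N → Subset N → Fin N → ℕ → Set
IsSetDist {N} G S u k =
  (Σ (Fin N) λ v → v ∈ S × IsDist G u v k) ×
  (∀ (v : Fin N) m → v ∈ S → IsDist G u v m → k ≤ m)

IsSetDistFun : ∀ {N} → SimpleGraph N → Subset N → (Fin N → ℕ) → Set
IsSetDistFun {N} G S d = ∀ (u : Fin N) → IsSetDist G S u (d u)

status : ∀ {N} → (Fin N → ℕ) → ℕ
status {N} d = sum (tabulate {n = N} d)

-- Peel off the first level: replacing every distance x by x ∸ 1 lowers the status by the number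
-- p of vertices outside S, and, as long as some vertex lies beyond level 1, removes at least two
-- vertices from the support because level 1 is then non-terminal. Iterating, 4σ(S) is at most
-- 4p + 4(p − 2) + 4(p − 4) + ⋯ = 4⌊(p + 1)²/4⌋, and p = n.
module Submission where

open import Defs
open import Data.Nat using (ℕ; _+_; _*_; _≤_; _<_)
open import Data.Nat.Divisibility using (_∣_)
open import Data.Fin using (Fin)
open import Data.Fin.Subset using (Subset; ∣_∣)
open import Data.Product using (Σ; ∃; _×_)
open import Relation.Binary.PropositionalEquality using (_≡_; _≢_)
open import Relation.Nullary using (¬_)

open import Data.Nat using (zero; suc; pred; _⊓_; _∸_; _<?_; _≤?_; z≤n; s≤s; s≤s⁻¹; z<s)
open import Data.Nat.Divisibility using (divides)
open import Data.Nat.Induction using (<-rec)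
open import Data.Nat.Properties
open import Algebra.Properties.CommutativeSemigroup +-commutativeSemigroup using (interchange; x∙yz≈y∙xz)
open import Data.Nat.Tactic.RingSolver using (solve-∀)
open import Data.Fin using (zero; suc)
open import Data.Fin.Properties using (any?)
open import Data.Fin.Subset using (_∈_; inside; outside)
open import Data.Fin.Subset.Properties using (drop-there)
open import Data.List.Properties using (tabulate-cong)
open import Data.Nat.ListAction using (sum)
open import Data.Product using (_,_; proj₁; proj₂)
open import Data.Vec using ([]; _∷_; here; there)
open import Function using (_∘_)
open import Relation.Nullary using (yes; no; contradiction)
open import Relation.Nullary.Decidable using (decidable-stable)
open import Relation.Binary.PropositionalEquality using (refl; sym; trans; cong; subst)

private
  variable
    N : ℕ

status-cong : {f g : Fin N → ℕ} → (∀ u → f u ≡ g u) → status f ≡ status g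
status-cong f≗g = cong sum (tabulate-cong f≗g)

status-+ : (f g : Fin N → ℕ) → status (λ u → f u + g u) ≡ status f + status g
status-+ {zero}  f g = refl
status-+ {suc N} f g = trans (cong (f zero + g zero +_) (status-+ (f ∘ suc) (g ∘ suc)))
                             (interchange (f zero) (g zero) _ _)

status-mono : {f g : Fin N → ℕ} → (∀ u → f u ≤ g u) → status f ≤ status g
status-mono {zero}  f≤g = z≤n
status-mono {suc N} f≤g = +-mono-≤ (f≤g zero) (status-mono (f≤g ∘ suc))

status-mono-< : {f g : Fin N → ℕ} → (∀ u → f u ≤ g u) → ∀ u → f u < g u → status f < status g
status-mono-< f≤g zero    fu<gu = +-mono-<-≤ fu<gu (status-mono (f≤g ∘ suc))
status-mono-< f≤g (suc u) fu<gu = +-mono-≤-< (f≤g zero) (status-mono-< (f≤g ∘ suc) u fu<gu)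

status-mono-<₂ : {f g : Fin N → ℕ} → (∀ u → f u ≤ g u) →
                 ∀ u v → u ≢ v → f u < g u → f v < g v → 2 + status f ≤ status g
status-mono-<₂ f≤g zero    zero    u≢v _ _ = contradiction refl u≢v
status-mono-<₂ {f = f} {g} f≤g zero (suc v) _ fu<gu fv<gv =
  subst (_≤ status g) (interchange 1 (f zero) 1 (status (f ∘ suc)))
    (+-mono-≤ fu<gu (status-mono-< (f≤g ∘ suc) v fv<gv))
status-mono-<₂ {f = f} {g} f≤g (suc u) zero _ fu<gu fv<gv =
  subst (_≤ status g) (interchange 1 (f zero) 1 (status (f ∘ suc)))
    (+-mono-≤ fv<gv (status-mono-< (f≤g ∘ suc) u fu<gu))
status-mono-<₂ {f = f} {g} f≤g (suc u) (suc v) u≢v fu<gu fv<gv =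
  subst (_≤ status g) (x∙yz≈y∙xz (f zero) 2 (status (f ∘ suc)))
    (+-mono-≤ (f≤g zero) (status-mono-<₂ (f≤g ∘ suc) u v (u≢v ∘ cong suc) fu<gu fv<gv))

Least : (ℕ → Set) → Set
Least P = Σ ℕ λ m → P m × (∀ k → P k → m ≤ k)

¬¬-least : (P : ℕ → Set) {k : ℕ} → P k → ¬ ¬ Least P
¬¬-least P {k} pk noLeast = <-rec (λ j → ¬ P j) would-be-least k pk
  where
  would-be-least : ∀ j → (∀ {i} → i < j → ¬ P i) → ¬ P j
  would-be-least j smaller pj = noLeast (j , pj , λ i pi → ≮⇒≥ (λ i<j → smaller i<j pi))

positives : (Fin N → ℕ) → ℕ
positives f = status (λ u → 1 ⊓ f u)

positives+∣zeros∣ : (f : Fin N → ℕ) (Z : Subset N) →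
                    (∀ u → f u ≡ 0 → u ∈ Z) → (∀ u → u ∈ Z → f u ≡ 0) →
                    positives f + ∣ Z ∣ ≡ N
positives+∣zeros∣ {zero}  f []      _     _     = refl
positives+∣zeros∣ {suc N} f (x ∷ Z) zero∈ ∈zero =
  cons x (f zero) (zero∈ zero) (∈zero zero)
    (positives+∣zeros∣ (f ∘ suc) Z (λ u → drop-there ∘ zero∈ (suc u)) (λ u → ∈zero (suc u) ∘ there))
  where
  cons : ∀ x y → (y ≡ 0 → zero ∈ x ∷ Z) → (zero ∈ x ∷ Z → y ≡ 0) →
         positives (f ∘ suc) + ∣ Z ∣ ≡ N → 1 ⊓ y + positives (f ∘ suc) + ∣ x ∷ Z ∣ ≡ suc N
  cons inside  y       _      ∈zero₀ tail rewrite ∈zero₀ here = trans (+-suc _ _) (cong suc tail)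
  cons outside zero    zero∈₀ _      tail with () ← zero∈₀ refl
  cons outside (suc y) _      _      tail = cong suc tail

LevelPair : (Fin N → ℕ) → ℕ → Set
LevelPair {N} f i = Σ (Fin N) λ u → Σ (Fin N) λ v → u ≢ v × f u ≡ i × f v ≡ i

NonTerminalLevelsHaveTwo : (Fin N → ℕ) → Set
NonTerminalLevelsHaveTwo {N} f = ∀ i (w : Fin N) → 1 ≤ i → i < f w → LevelPair f i

NonTerminalLevelsHaveTwo-pred : {f : Fin N → ℕ} →
                                NonTerminalLevelsHaveTwo f → NonTerminalLevelsHaveTwo (pred ∘ f)
NonTerminalLevelsHaveTwo-pred two i w 1≤i i<fw with two (suc i) w z<s (pred-cancel-< {m = suc i} i<fw)
... | u , v , u≢v , fu≡1+i , fv≡1+i = u , v , u≢v , cong pred fu≡1+i , cong pred fv≡1+i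

-- bound p = 4⌊(p + 1)²/4⌋, attained by levels of sizes 2, 2, …, 2 (followed by 1 if p is odd).
bound : ℕ → ℕ
bound zero          = 0
bound (suc zero)    = 4
bound (suc (suc p)) = bound p + 4 * (2 + p)

4*≤bound : ∀ p → 4 * p ≤ bound p
4*≤bound zero          = z≤n
4*≤bound (suc zero)    = ≤-refl
4*≤bound (suc (suc p)) = m≤n+m _ (bound p)

bound-even : ∀ q → bound (q * 2) ≡ q * 2 * (q * 2) + 2 * (q * 2)
bound-even zero    = refl
bound-even (suc q) = trans (cong (_+ 4 * (2 + q * 2)) (bound-even q)) (expand (q * 2))
  where
  expand : ∀ p → p * p + 2 * p + 4 * (2 + p) ≡ (2 + p) * (2 + p) + 2 * (2 + p)
  expand = solve-∀

bound≤ : ∀ p → bound p ≤ p * p + 2 * p + 1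
bound≤ zero          = z≤n
bound≤ (suc zero)    = ≤-refl
bound≤ (suc (suc p)) = ≤-trans (+-monoˡ-≤ (4 * (2 + p)) (bound≤ p)) (≤-reflexive (expand p))
  where
  expand : ∀ p → p * p + 2 * p + 1 + 4 * (2 + p) ≡ (2 + p) * (2 + p) + 2 * (2 + p) + 1
  expand = solve-∀

status-pred : (f : Fin N → ℕ) → status f ≡ status (pred ∘ f) + positives f
status-pred f = trans (status-cong (λ u → pred+sign (f u))) (status-+ (pred ∘ f) (λ u → 1 ⊓ f u))
  where
  pred+sign : ∀ x → x ≡ pred x + 1 ⊓ x
  pred+sign zero    = refl
  pred+sign (suc x) = sym (+-comm x 1)

positives-pred : {f : Fin N → ℕ} → LevelPair f 1 → 2 + positives (pred ∘ f) ≤ positives f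
positives-pred (u , v , u≢v , fu≡1 , fv≡1) =
  status-mono-<₂ (λ _ → ⊓-monoʳ-≤ 1 pred[n]≤n) u v u≢v (drops fu≡1) (drops fv≡1)
  where
  drops : ∀ {x} → x ≡ 1 → 1 ⊓ pred x < 1 ⊓ x
  drops refl = ≤-refl

status≡positives : {f : Fin N → ℕ} → (∀ u → f u ≤ 1) → status f ≡ positives f
status≡positives f≤1 = status-cong (λ u → sign-fixes (f≤1 u))
  where
  sign-fixes : ∀ {x} → x ≤ 1 → x ≡ 1 ⊓ x
  sign-fixes z≤n       = refl
  sign-fixes (s≤s z≤n) = refl

status-bound : ∀ p (f : Fin N → ℕ) → NonTerminalLevelsHaveTwo f → positives f ≤ p →
               4 * status f ≤ bound p
status-bound p f two f≤p with any? (λ w → 1 <? f w)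
... | no noneBeyond1 = begin
  4 * status f    ≡⟨ cong (4 *_) (status≡positives (λ u → ≮⇒≥ (λ 1<fu → noneBeyond1 (u , 1<fu)))) ⟩
  4 * positives f ≤⟨ *-monoʳ-≤ 4 f≤p ⟩
  4 * p           ≤⟨ 4*≤bound p ⟩
  bound p         ∎
  where open ≤-Reasoning
... | yes (w , 1<fw) = peel p f≤p (≤-trans (positives-pred (two 1 w ≤-refl 1<fw)) f≤p)
  where
  open ≤-Reasoning
  peel : ∀ p → positives f ≤ p → 2 + positives (pred ∘ f) ≤ p → 4 * status f ≤ bound p
  peel (suc (suc p)) f≤p (s≤s (s≤s f′≤p)) = begin
    4 * status f                            ≡⟨ cong (4 *_) (status-pred f) ⟩
    4 * (status (pred ∘ f) + positives f)   ≡⟨ *-distribˡ-+ 4 (status (pred ∘ f)) (positives f) ⟩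
    4 * status (pred ∘ f) + 4 * positives f ≤⟨ +-mono-≤ (status-bound p (pred ∘ f) (NonTerminalLevelsHaveTwo-pred two) f′≤p)
                                                        (*-monoʳ-≤ 4 f≤p) ⟩
    bound p + 4 * (2 + p)                   ∎

module _ {G : SimpleGraph N} {S : Subset N} {d : Fin N → ℕ} (isDist : IsSetDistFun G S d) where

  -- A shortest walk exists only classically, but the conclusion is decidable.
  d≤walk : ∀ {u v m} → v ∈ S → Walk G u v m → d u ≤ m
  d≤walk {u} {v} {m} v∈S walk = decidable-stable (d u ≤? m) λ d≰m →
    ¬¬-least (Walk G u v) walk λ (k , walkₖ , shortest) →
      d≰m (≤-trans (proj₂ (isDist u) v k v∈S (walkₖ , shortest)) (shortest m walk))

  lower-level : ∀ u {k} → d u ≡ suc k → ∃ λ w → d w ≡ k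
  lower-level u {k} du≡1+k with subst (IsSetDist G S u) du≡1+k (isDist u)
  ... | (v , v∈S , step {w = w} u~w walk , _) , _ = w , ≤-antisym (d≤walk v∈S walk) k≤dw
    where
    k≤dw : k ≤ d w
    k≤dw with proj₁ (isDist w)
    ... | v′ , v′∈S , walk′ , _ = s≤s⁻¹ (subst (_≤ suc (d w)) du≡1+k (d≤walk v′∈S (step u~w walk′)))

  occupied-below : ∀ u {k} → k ≤ d u → ∃ λ w → d w ≡ k
  occupied-below u {k} k≤du = descend u (d u ∸ k) (sym (m∸n+n≡m k≤du))
    where
    descend : ∀ u t → d u ≡ t + k → ∃ λ w → d w ≡ k
    descend u zero    du≡k   = u , du≡k
    descend u (suc t) du≡1+t+k with lower-level u du≡1+t+k
    ... | w , dw≡t+k = descend w t dw≡t+k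

  zero⇒∈ : ∀ u → d u ≡ 0 → u ∈ S
  zero⇒∈ u du≡0 with subst (IsSetDist G S u) du≡0 (isDist u)
  ... | (v , v∈S , here , _) , _ = v∈S

  ∈⇒zero : ∀ u → u ∈ S → d u ≡ 0
  ∈⇒zero u u∈S = n≤0⇒n≡0 (d≤walk u∈S here)

lemma3 : (n s : ℕ) → 1 ≤ s →
  (G : SimpleGraph (n + s)) → Connected G →
  (S : Subset (n + s)) → ∣ S ∣ ≡ s →
  (d : Fin (n + s) → ℕ) → IsSetDistFun G S d →
  (∀ (i : ℕ) → 1 ≤ i →
    (∃ λ (u : Fin (n + s)) → d u ≡ i) →
    (∃ λ (w : Fin (n + s)) → i < d w) →
    Σ (Fin (n + s)) λ u → Σ (Fin (n + s)) λ v → u ≢ v × d u ≡ i × d v ≡ i) →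
  (2 ∣ n → 4 * status d ≤ n * n + 2 * n) ×
  (¬ (2 ∣ n) → 4 * status d ≤ n * n + 2 * n + 1)
lemma3 n s _ G _ S ∣S∣≡s d isDist pairs = even , odd
  where
  two : NonTerminalLevelsHaveTwo d
  two i w 1≤i i<dw = pairs i 1≤i (occupied-below isDist w (<⇒≤ i<dw)) (w , i<dw)

  positives≡n : positives d ≡ n
  positives≡n = +-cancelʳ-≡ s (positives d) n
    (trans (cong (positives d +_) (sym ∣S∣≡s)) (positives+∣zeros∣ d S (zero⇒∈ isDist) (∈⇒zero isDist)))

  4σ≤bound : 4 * status d ≤ bound n
  4σ≤bound = status-bound n d two (≤-reflexive positives≡n)

  even : 2 ∣ n → 4 * status d ≤ n * n + 2 * n
  even (divides q refl) = subst (4 * status d ≤_) (bound-even q) 4σ≤bound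

  odd : ¬ (2 ∣ n) → 4 * status d ≤ n * n + 2 * n + 1
  odd _ = ≤-trans 4σ≤bound (bound≤ n)
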